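{- Fix $h\in\mathbb N$. Among all $h$-flipclasses of all symmetric groups $\mathfrak S_n$ ($n\in\mathbb N^+$), there are only finitely many isomorphism classes.
   Context: $\mathfrak S_n$: symmetric group on $[n]$, $\ell$ Coxeter length, $T$ transpositions. Bruhat graph: edge $x\xrightarrow{t}y$ labelled $t$ whenever $yx^{ -1}=t\in T$ and $\ell(x)<\ell(y)$. Between two elements there are 0 or 2 paths of length 2, each the flip of the other; $f_i$ ($i\in[h-1]$) replaces the subpath $x_{i-1}\to x_i\to x_{i+1}$ of a path $x_0\to\cdots\to x_h$ by its flip; an $h$-flipclass of $\mathfrak S_n$ is an orbit, in the set of length-$h$ paths from $u$ to $v$ (some $u,v$), of the group generated by $f_1,\dots,f_{h-1}$. An isomorphism from an $h$-flipclass $F$ of $\mathfrak S_n$ to an $h$-flipclass $F'$ of $\mathfrak S_m$ is a pair $(f,g)$: $f$ a bijection from the set of permutations occurring in paths of $F$ to that of $F'$, mapping paths of $F$ to paths of $F'$ and inducing a bijection $F\to F'$ commuting with all flip operators; $g$ a bijection from the set of transpositions labelling paths of $F$ to that of $F'$ such that $f(\Gamma)$ has label sequence $(g(t_1),\dots,g(t_h))$ whenever $\Gamma$ has $(t_1,\dots,t_h)$, and $g$ is order preserving for the lexicographic orders $(1,2)\prec(1,3)\prec\cdots\prec(2,3)\prec\cdots$ on transpositions. -}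

module Defs where

open import Data.Nat as ℕ using (ℕ; zero; suc; _≤_)
open import Data.Fin as Fin using (Fin; zero; suc; toℕ; inject₁; _≟_)
open import Data.Fin.Properties using () renaming (_<?_ to _<ᶠ?_)
open import Data.Vec using (Vec; lookup)
open import Data.List using (List; length; filter; allFin; cartesianProduct)
open import Data.Product using (Σ; _×_; _,_; proj₁; proj₂; ∃)
open import Data.Sum using (_⊎_)
open import Relation.Nullary using (¬_; yes; no)
open import Relation.Nullary.Decidable using (_×-dec_)
open import Relation.Binary.PropositionalEquality using (_≡_; _≢_; refl)
open import Relation.Binary.Construct.Closure.ReflexiveTransitive using (Star)

-- Permutations of [n] (encoded as Fin n), in one-line notation:
-- the vector (x(0), …, x(n-1)), required to be injective.
-- The proof field is irrelevant, so equality of permutations is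
-- equality of their one-line vectors.

record Perm (n : ℕ) : Set where
  constructor perm
  field
    vec     : Vec (Fin n) n
    .isPerm : ∀ i j → lookup vec i ≡ lookup vec j → i ≡ j
open Perm public

_⟨_⟩ : ∀ {n} → Perm n → Fin n → Fin n
x ⟨ k ⟩ = lookup (vec x) k

-- Coxeter length of a permutation = number of inversions
-- (pairs i < j with x(i) > x(j)).
len : ∀ {n} → Perm n → ℕ
len {n} x =
  length (filter (λ p → (proj₁ p <ᶠ? proj₂ p) ×-dec (x ⟨ proj₂ p ⟩ <ᶠ? x ⟨ proj₁ p ⟩))
                 (cartesianProduct (allFin n) (allFin n)))

record Transp (n : ℕ) : Set where
  constructor tr
  field
    fst  : Fin n
    snd  : Fin n
    .lt  : fst Fin.< snd
open Transp public

swap : ∀ {n} → Transp n → Fin n → Fin n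
swap t k with k ≟ fst t
... | yes _ = snd t
... | no _ with k ≟ snd t
...   | yes _ = fst t
...   | no _  = k

_≺_ : ∀ {n} → Transp n → Transp n → Set
s ≺ t = (fst s Fin.< fst t) ⊎ (fst s ≡ fst t × snd s Fin.< snd t)

-- Bruhat graph edge  x --t--> y :  y x⁻¹ = t  (i.e. y = t ∘ x) and ℓ(x) < ℓ(y).

Edge : ∀ {n} → Perm n → Transp n → Perm n → Set
Edge x t y = (∀ k → y ⟨ k ⟩ ≡ swap t (x ⟨ k ⟩)) × (len x ℕ.< len y)

-- A path x₀ → x₁ → ⋯ → x_h in the Bruhat graph, with its labels.
-- (The labels are determined by the vertices; the edge proofs are
-- irrelevant, so equality of paths is equality of vertex/label lists.)
record Path (n h : ℕ) : Set where
  constructor path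
  field
    verts  : Vec (Perm n) (suc h)
    labs   : Vec (Transp n) h
    .edges : ∀ (k : Fin h) → Edge (lookup verts (inject₁ k)) (lookup labs k) (lookup verts (suc k))
open Path public

Interior : ∀ {h} → Fin (suc h) → Set
Interior {h} k = 1 ≤ toℕ k × toℕ k ℕ.< h

-- Γ' = f_k(Γ): Γ' is the (other) path obtained by replacing the
-- subpath x_{k-1} → x_k → x_{k+1} by its flip.  Since between two
-- elements there are 0 or 2 paths of length 2, this is exactly: Γ' is
-- a path, agrees with Γ at every vertex except position k, and differs
-- from Γ at position k.
Flip : ∀ {n h} → Fin (suc h) → Path n h → Path n h → Set
Flip k Γ Γ' =
  (∀ j → j ≢ k → lookup (verts Γ) j ≡ lookup (verts Γ') j) ×
  (lookup (verts Γ) k ≢ lookup (verts Γ') k)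

FlipStep : ∀ {n h} → Path n h → Path n h → Set
FlipStep Γ Γ' = Σ _ λ k → Interior k × Flip k Γ Γ'

-- The h-flipclass of a path Γ₀: its orbit under ⟨f₁,…,f_{h-1}⟩
-- (the f_i are involutions, so the orbit is the reflexive–transitive
-- closure of single flips).

InF : ∀ {n h} → Path n h → Path n h → Set
InF Γ₀ Γ = Star FlipStep Γ₀ Γ

InV : ∀ {n h} → Path n h → Perm n → Set
InV Γ₀ x = Σ _ λ Γ → InF Γ₀ Γ × ∃ λ k → lookup (verts Γ) k ≡ x

InL : ∀ {n h} → Path n h → Transp n → Set
InL Γ₀ t = Σ _ λ Γ → InF Γ₀ Γ × ∃ λ k → lookup (labs Γ) k ≡ t

record Iso {n m h : ℕ} (Γ₀ : Path n h) (Δ₀ : Path m h) : Set where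
  field
    f      : (x : Perm n) → .(InV Γ₀ x) → Perm m
    f-into : ∀ x (p : InV Γ₀ x) → InV Δ₀ (f x p)
    f-inj  : ∀ x y (p : InV Γ₀ x) (q : InV Γ₀ y) → f x p ≡ f y q → x ≡ y
    f-surj : ∀ y → InV Δ₀ y → Σ _ λ x → Σ (InV Γ₀ x) λ p → f x p ≡ y
    φ       : (Γ : Path n h) → .(InF Γ₀ Γ) → Path m h
    φ-verts : ∀ Γ (p : InF Γ₀ Γ) k →
              lookup (verts (φ Γ p)) k ≡ f (lookup (verts Γ) k) (Γ , p , k , refl)
    φ-into  : ∀ Γ (p : InF Γ₀ Γ) → InF Δ₀ (φ Γ p)
    φ-inj   : ∀ Γ Γ' (p : InF Γ₀ Γ) (p' : InF Γ₀ Γ') → φ Γ p ≡ φ Γ' p' → Γ ≡ Γ'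
    φ-surj  : ∀ Δ → InF Δ₀ Δ → Σ _ λ Γ → Σ (InF Γ₀ Γ) λ p → φ Γ p ≡ Δ
    φ-flip  : ∀ Γ Γ' (p : InF Γ₀ Γ) (p' : InF Γ₀ Γ') k → Interior k →
              Flip k Γ Γ' → Flip k (φ Γ p) (φ Γ' p')
    g      : (t : Transp n) → .(InL Γ₀ t) → Transp m
    g-into : ∀ t (p : InL Γ₀ t) → InL Δ₀ (g t p)
    g-inj  : ∀ s t (p : InL Γ₀ s) (q : InL Γ₀ t) → g s p ≡ g t q → s ≡ t
    g-surj : ∀ t → InL Δ₀ t → Σ _ λ s → Σ (InL Γ₀ s) λ p → g s p ≡ t
    g-labs : ∀ Γ (p : InF Γ₀ Γ) k →
             lookup (labs (φ Γ p)) k ≡ g (lookup (labs Γ) k) (Γ , p , k , refl)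
    g-mono : ∀ s t (p : InL Γ₀ s) (q : InL Γ₀ t) → s ≺ t → g s p ≺ g t q

-- A Bruhat edge x → t ∘ x only moves the two values of t, so the labels of a path
-- of length h involve at most 2h values.  When n > 2h some value c is moved by no
-- label; it then sits at one position q in every vertex, and so it does in every
-- path of the flipclass, because a flip only replaces a vertex lying between two
-- vertices with c at q.  Deleting c from position q sends the flipclass
-- bijectively, flip-equivariantly and label-order-preservingly onto a flipclass
-- of 𝔖_{n-1}: by the inversion criterion ℓ(x) < ℓ((a b) ∘ x) ⇔ x⁻¹(a) < x⁻¹(b)
-- (a < b), deletion preserves and reflects Bruhat edges.  Iterating, every
-- h-flipclass is isomorphic to one of 𝔖_m with m ≤ 2h + 1, of which there are
-- only finitely many.

module Submission where

open import Defs
open import Data.Nat as ℕ using (ℕ; zero; suc; _+_; _*_)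
import Data.Nat.Properties as ℕₚ
open import Data.Fin as Fin using (Fin; zero; suc; inject₁; lower₁; punchIn; punchOut; combine)
open import Data.Fin.Properties
  using (_≟_; _<?_; any?; all?; ¬∀⟶∃¬; injective⇒≤; combine-injective; inject₁-lower₁; ≤̄⇒inject₁<;
         punchInᵢ≢i; punchIn-injective; punchOut-injective; punchOut-cong; punchIn-punchOut; punchOut-punchIn;
         punchIn-mono-≤; punchIn-cancel-≤; punchOut-cancel-≤)
import Data.Fin.Properties as Finₚ
open import Data.Fin.Induction using (<-weakInduction)
open import Data.Fin.Permutation using () renaming (transpose to transposeₚ)
open import Data.Fin.Permutation.Components using (transpose)
open import Algebra.Properties.CommutativeMonoid.Sum ℕₚ.+-0-commutativeMonoid
  using (sum; sum-permute; ∑-distrib-+; sum-cong-≗)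
open import Data.Vec using (Vec; []; _∷_; lookup; tabulate)
open import Data.Vec.Properties using (lookup∘tabulate; tabulate∘lookup; tabulate-cong)
open import Data.List as List
  using (List; [_]; length; filter; map; _++_; mapMaybe; cartesianProduct; cartesianProductWith; allFin)
open import Data.List.Properties using (length-++; filter-++; map-tabulate)
open import Data.List.Membership.Propositional using (_∈_)
open import Data.List.Membership.Propositional.Properties
  using (∈-map⁺; ∈-++⁺ˡ; ∈-++⁺ʳ; ∈-cartesianProductWith⁺; ∈-allFin)
open import Data.List.Relation.Unary.Any as Any using (Any; here)
open import Data.List.Relation.Unary.Any.Properties using (mapMaybe⁺; map⁺)
open import Data.Maybe using (Maybe; just; nothing)
import Data.Maybe.Relation.Unary.Any as Maybe
open import Data.Product using (Σ; ∃; ∃₂; _×_; _,_; proj₁; proj₂)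
open import Data.Sum using (inj₁; inj₂)
open import Data.Empty using (⊥-elim; ⊥-elim-irr)
open import Function using (_∘_; id)
open import Relation.Nullary using (Dec; yes; no; ¬_)
open import Relation.Nullary.Decidable using (_×-dec_; _→-dec_; recompute)
open import Relation.Nullary.Recomputable using (¬-recompute)
open import Relation.Unary using (Pred; Decidable)
open import Relation.Binary using (tri<; tri≈; tri>)
open import Relation.Binary.Construct.Closure.ReflexiveTransitive using (Star; ε; _◅_; gmap)
open import Relation.Binary.PropositionalEquality
  using (_≡_; _≢_; refl; sym; trans; cong; cong₂; subst; subst₂; module ≡-Reasoning)

fst<snd : ∀ {n} (t : Transp n) → fst t Fin.< snd t
fst<snd (tr a b a<b) = recompute (a <? b) a<b

fst≢snd : ∀ {n} (t : Transp n) → fst t ≢ snd t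
fst≢snd t = Finₚ.<⇒≢ (fst<snd t)

perm-injective : ∀ {n} (x : Perm n) {i j} → x ⟨ i ⟩ ≡ x ⟨ j ⟩ → i ≡ j
perm-injective (perm _ injective) {i} {j} e = recompute (i ≟ j) (injective i j e)

data TransposeView {n} (i j k l : Fin n) : Set where
  at-fst    : k ≡ i → l ≡ j → TransposeView i j k l
  at-snd    : k ≡ j → l ≡ i → TransposeView i j k l
  elsewhere : k ≢ i → k ≢ j → l ≡ k → TransposeView i j k l

transposeView : ∀ {n} (i j k : Fin n) → TransposeView i j k (transpose i j k)
transposeView i j k with k ≟ i
... | yes k≡i = at-fst k≡i refl
... | no k≢i with k ≟ j
...   | yes k≡j = at-snd k≡j refl
...   | no k≢j = elsewhere k≢i k≢j refl

swapView : ∀ {n} (t : Transp n) k → TransposeView (fst t) (snd t) k (swap t k)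
swapView t k with k ≟ fst t
... | yes k≡a = at-fst k≡a refl
... | no k≢a with k ≟ snd t
...   | yes k≡b = at-snd k≡b refl
...   | no k≢b = elsewhere k≢a k≢b refl

swap-fst : ∀ {n} (t : Transp n) → swap t (fst t) ≡ snd t
swap-fst t with swapView t (fst t)
... | at-fst _ e = e
... | at-snd a≡b _ = ⊥-elim (fst≢snd t a≡b)
... | elsewhere a≢a _ _ = ⊥-elim (a≢a refl)

swap-snd : ∀ {n} (t : Transp n) → swap t (snd t) ≡ fst t
swap-snd t with swapView t (snd t)
... | at-fst b≡a _ = ⊥-elim (fst≢snd t (sym b≡a))
... | at-snd _ e = e
... | elsewhere _ b≢b _ = ⊥-elim (b≢b refl)

swap-elsewhere : ∀ {n} (t : Transp n) {k} → k ≢ fst t → k ≢ snd t → swap t k ≡ k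
swap-elsewhere t {k} k≢a k≢b with swapView t k
... | at-fst k≡a _ = ⊥-elim (k≢a k≡a)
... | at-snd k≡b _ = ⊥-elim (k≢b k≡b)
... | elsewhere _ _ e = e

swap-involutive : ∀ {n} (t : Transp n) k → swap t (swap t k) ≡ k
swap-involutive t k with swapView t k
... | at-fst refl e = trans (cong (swap t) e) (swap-snd t)
... | at-snd refl e = trans (cong (swap t) e) (swap-fst t)
... | elsewhere _ _ e = trans (cong (swap t) e) e

-- Counting inversions

indicator : ∀ {p} {P : Set p} → Dec P → ℕ
indicator (yes _) = 1
indicator (no _) = 0

indicator-mono : ∀ {p q} {P : Set p} {Q : Set q} (P? : Dec P) (Q? : Dec Q) →
                 (P → Q) → indicator P? ℕ.≤ indicator Q?
indicator-mono (yes _) (yes _) _ = ℕₚ.≤-refl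
indicator-mono (yes p) (no ¬q) f = ⊥-elim (¬q (f p))
indicator-mono (no _)  _       _ = ℕ.z≤n

indicator-cong : ∀ {p q} {P : Set p} {Q : Set q} (P? : Dec P) (Q? : Dec Q) →
                 (P → Q) → (Q → P) → indicator P? ≡ indicator Q?
indicator-cong P? Q? P→Q Q→P = ℕₚ.≤-antisym (indicator-mono P? Q? P→Q) (indicator-mono Q? P? Q→P)

indicator-no : ∀ {p} {P : Set p} (P? : Dec P) → ¬ P → indicator P? ≡ 0
indicator-no (yes p) ¬p = ⊥-elim (¬p p)
indicator-no (no _)  _  = refl

indicator-yes : ∀ {p} {P : Set p} (P? : Dec P) → P → indicator P? ≡ 1
indicator-yes (yes _) _ = refl
indicator-yes (no ¬p) p = ⊥-elim (¬p p)

sum-mono-≤ : ∀ {n} (f g : Fin n → ℕ) → (∀ i → f i ℕ.≤ g i) → sum f ℕ.≤ sum g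
sum-mono-≤ {zero}  f g f≤g = ℕ.z≤n
sum-mono-≤ {suc n} f g f≤g = ℕₚ.+-mono-≤ (f≤g zero) (sum-mono-≤ (f ∘ suc) (g ∘ suc) (f≤g ∘ suc))

sum-mono-< : ∀ {n} (f g : Fin n → ℕ) → (∀ i → f i ℕ.≤ g i) → ∀ k → f k ℕ.< g k → sum f ℕ.< sum g
sum-mono-< f g f≤g zero    fk<gk = ℕₚ.+-mono-<-≤ fk<gk (sum-mono-≤ (f ∘ suc) (g ∘ suc) (f≤g ∘ suc))
sum-mono-< f g f≤g (suc k) fk<gk = ℕₚ.+-mono-≤-< (f≤g zero) (sum-mono-< (f ∘ suc) (g ∘ suc) (f≤g ∘ suc) k fk<gk)

transpose-fst : ∀ {n} (i j : Fin n) → transpose i j i ≡ j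
transpose-fst i j with transposeView i j i
... | at-fst _ e = e
... | at-snd i≡j e = trans e i≡j
... | elsewhere i≢i _ _ = ⊥-elim (i≢i refl)

transpose-snd : ∀ {n} (i j : Fin n) → transpose i j j ≡ i
transpose-snd i j with transposeView i j j
... | at-fst j≡i e = trans e j≡i
... | at-snd _ e = e
... | elsewhere _ j≢j _ = ⊥-elim (j≢j refl)

sum-transpose : ∀ {n} (i j : Fin n) (f : Fin n → ℕ) → sum f ≡ sum (f ∘ transpose i j)
sum-transpose i j f = sum-permute f (transposeₚ i j)

module _ {N : ℕ} where

  Inversion : (Fin N → Fin N) → Fin N → Fin N → Set
  Inversion X p r = p Fin.< r × X r Fin.< X p

  inversion? : ∀ X p r → Dec (Inversion X p r)
  inversion? X p r = (p <? r) ×-dec (X r <? X p)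

  inversionsFrom : (Fin N → Fin N) → Fin N → ℕ
  inversionsFrom X p = sum λ r → indicator (inversion? X p r)

  inversions : (Fin N → Fin N) → ℕ
  inversions X = sum (inversionsFrom X)

  inversions-cong : ∀ {X Y : Fin N → Fin N} → (∀ k → X k ≡ Y k) → inversions X ≡ inversions Y
  inversions-cong {X} {Y} X≗Y = sum-cong-≗ λ p → sum-cong-≗ λ r → same p r
    where
    same : ∀ p r → indicator (inversion? X p r) ≡ indicator (inversion? Y p r)
    same p r rewrite X≗Y p | X≗Y r = refl

  private
    𝟙 : (Fin N → Fin N) → Fin N → Fin N → ℕ
    𝟙 X p r = indicator (inversion? X p r)

    𝟙≡0 : ∀ X p r → ¬ Inversion X p r → 𝟙 X p r ≡ 0
    𝟙≡0 X p r = indicator-no (inversion? X p r)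

  module _ (X : Fin N → Fin N) {i j : Fin N} (i<j : i Fin.< j) (Xi<Xj : X i Fin.< X j) where

    private
      τ : Fin N → Fin N
      τ = transpose i j

      Y : Fin N → Fin N
      Y = X ∘ τ

      Yi≡Xj : Y i ≡ X j
      Yi≡Xj = cong X (transpose-fst i j)

      Yj≡Xi : Y j ≡ X i
      Yj≡Xi = cong X (transpose-snd i j)

      Yi>Yj : Y j Fin.< Y i
      Yi>Yj = subst₂ Fin._<_ (sym Yj≡Xi) (sym Yi≡Xj) Xi<Xj

      Yk≡Xk : ∀ {k} → k ≢ i → k ≢ j → Y k ≡ X k
      Yk≡Xk {k} k≢i k≢j with transposeView i j k
      ... | at-fst k≡i _ = ⊥-elim (k≢i k≡i)
      ... | at-snd k≡j _ = ⊥-elim (k≢j k≡j)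
      ... | elsewhere _ _ e = cong X e

    inversionsFrom-before : ∀ {p} → p Fin.< i → inversionsFrom X p ≡ inversionsFrom Y p
    inversionsFrom-before {p} p<i = trans (sum-transpose i j (𝟙 X p)) (sum-cong-≗ λ r →
        indicator-cong (inversion? X p (τ r)) (inversion? Y p r)
          (λ (p<τr , lt) → τ-preserves-> r p<τr , subst (Y r Fin.<_) (sym Yp≡Xp) lt)
          (λ (p<r  , lt) → τ-reflects->  r p<r  , subst (Y r Fin.<_) Yp≡Xp lt))
      where
      p<j = Finₚ.<-trans p<i i<j
      Yp≡Xp : Y p ≡ X p
      Yp≡Xp = Yk≡Xk (Finₚ.<⇒≢ p<i) (Finₚ.<⇒≢ p<j)
      τ-preserves-> : ∀ r → p Fin.< τ r → p Fin.< r
      τ-preserves-> r p<τr with transposeView i j r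
      ... | at-fst refl _ = p<i
      ... | at-snd refl _ = p<j
      ... | elsewhere _ _ e = subst (p Fin.<_) e p<τr
      τ-reflects-> : ∀ r → p Fin.< r → p Fin.< τ r
      τ-reflects-> r p<r with transposeView i j r
      ... | at-fst refl e = subst (p Fin.<_) (sym e) p<j
      ... | at-snd refl e = subst (p Fin.<_) (sym e) p<i
      ... | elsewhere _ _ e = subst (p Fin.<_) (sym e) p<r

    inversionsFrom-after : ∀ {p} → p ≢ i → p ≢ j → i Fin.< p → inversionsFrom X p ℕ.≤ inversionsFrom Y p
    inversionsFrom-after {p} p≢i p≢j i<p = sum-mono-≤ _ _ λ r →
        indicator-mono (inversion? X p r) (inversion? Y p r) (still-inverted r)
      where
      still-inverted : ∀ r → Inversion X p r → Inversion Y p r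
      still-inverted r (p<r , Xr<Xp) with transposeView i j r
      ... | at-fst refl _ = ⊥-elim (Finₚ.<-asym p<r i<p)
      ... | at-snd refl _ = p<r , subst₂ Fin._<_ (sym Yj≡Xi) (sym (Yk≡Xk p≢i p≢j)) (Finₚ.<-trans Xi<Xj Xr<Xp)
      ... | elsewhere _ _ e = p<r , subst₂ Fin._<_ (sym (cong X e)) (sym (Yk≡Xk p≢i p≢j)) Xr<Xp

    private
      pair-elsewhere : ∀ r → r ≢ i → r ≢ j → Dec (j Fin.< r) →
                       𝟙 X i r + 𝟙 X j r ℕ.≤ 𝟙 Y i r + 𝟙 Y j r
      pair-elsewhere r r≢i r≢j (yes j<r) = ℕₚ.≤-reflexive (begin
          𝟙 X i r + 𝟙 X j r  ≡⟨ cong₂ _+_ Xi≡Yj Xj≡Yi ⟩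
          𝟙 Y j r + 𝟙 Y i r  ≡⟨ ℕₚ.+-comm (𝟙 Y j r) (𝟙 Y i r) ⟩
          𝟙 Y i r + 𝟙 Y j r  ∎)
        where
        open ≡-Reasoning
        i<r = Finₚ.<-trans i<j j<r
        Yr≡Xr = Yk≡Xk r≢i r≢j
        Xi≡Yj : 𝟙 X i r ≡ 𝟙 Y j r
        Xi≡Yj = indicator-cong (inversion? X i r) (inversion? Y j r)
          (λ (_ , lt) → j<r , subst₂ Fin._<_ (sym Yr≡Xr) (sym Yj≡Xi) lt)
          (λ (_ , lt) → i<r , subst₂ Fin._<_ Yr≡Xr Yj≡Xi lt)
        Xj≡Yi : 𝟙 X j r ≡ 𝟙 Y i r
        Xj≡Yi = indicator-cong (inversion? X j r) (inversion? Y i r)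
          (λ (_ , lt) → i<r , subst₂ Fin._<_ (sym Yr≡Xr) (sym Yi≡Xj) lt)
          (λ (_ , lt) → j<r , subst₂ Fin._<_ Yr≡Xr Yi≡Xj lt)
      pair-elsewhere r r≢i r≢j (no j≮r) = begin
          𝟙 X i r + 𝟙 X j r  ≡⟨ cong (𝟙 X i r +_) (𝟙≡0 _ j r (j≮r ∘ proj₁)) ⟩
          𝟙 X i r + 0        ≤⟨ ℕₚ.+-monoˡ-≤ 0 Xi≤Yi ⟩
          𝟙 Y i r + 0        ≡⟨ cong (𝟙 Y i r +_) (sym (𝟙≡0 _ j r (j≮r ∘ proj₁))) ⟩
          𝟙 Y i r + 𝟙 Y j r  ∎
        where
        open ℕₚ.≤-Reasoning
        Xi≤Yi : 𝟙 X i r ℕ.≤ 𝟙 Y i r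
        Xi≤Yi = indicator-mono (inversion? X i r) (inversion? Y i r) λ (i<r , Xr<Xi) →
          i<r , subst₂ Fin._<_ (sym (Yk≡Xk r≢i r≢j)) (sym Yi≡Xj) (Finₚ.<-trans Xr<Xi Xi<Xj)

      pair-at-i : 𝟙 X i i + 𝟙 X j i ≡ 0
      pair-at-i = cong₂ _+_ (𝟙≡0 X i i (Finₚ.<-irrefl refl ∘ proj₁)) (𝟙≡0 X j i (Finₚ.<-asym i<j ∘ proj₁))

      pair-at-j : 𝟙 X i j + 𝟙 X j j ≡ 0
      pair-at-j = cong₂ _+_ (𝟙≡0 X i j (Finₚ.<-asym Xi<Xj ∘ proj₂)) (𝟙≡0 X j j (Finₚ.<-irrefl refl ∘ proj₁))

      PairGrows : Fin N → Set
      PairGrows r = 𝟙 X i r + 𝟙 X j r ℕ.≤ 𝟙 Y i r + 𝟙 Y j r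

      pair-≤ : ∀ r → PairGrows r
      pair-≤ r with transposeView i j r
      ... | at-fst r≡i _ = subst PairGrows (sym r≡i) (ℕₚ.≤-trans (ℕₚ.≤-reflexive pair-at-i) ℕ.z≤n)
      ... | at-snd r≡j _ = subst PairGrows (sym r≡j) (ℕₚ.≤-trans (ℕₚ.≤-reflexive pair-at-j) ℕ.z≤n)
      ... | elsewhere r≢i r≢j _ = pair-elsewhere r r≢i r≢j (j <? r)

      pair-< : 𝟙 X i j + 𝟙 X j j ℕ.< 𝟙 Y i j + 𝟙 Y j j
      pair-< rewrite pair-at-j | indicator-yes (inversion? Y i j) (i<j , Yi>Yj) = ℕ.s≤s ℕ.z≤n

    inversionsFrom-pair : inversionsFrom X i + inversionsFrom X j ℕ.< inversionsFrom Y i + inversionsFrom Y j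
    inversionsFrom-pair = subst₂ ℕ._<_ (∑-distrib-+ (𝟙 X i) (𝟙 X j)) (∑-distrib-+ (𝟙 Y i) (𝟙 Y j))
      (sum-mono-< _ _ pair-≤ j pair-<)

    private
      SumGrows : Fin N → Fin N → Set
      SumGrows p q = inversionsFrom X p + inversionsFrom X q ℕ.≤ inversionsFrom Y p + inversionsFrom Y q

      orbit-≤ : ∀ p → SumGrows p (τ p)
      orbit-≤ p with transposeView i j p
      ... | at-fst p≡i τp≡j = subst₂ SumGrows (sym p≡i) (sym τp≡j) (ℕₚ.<⇒≤ inversionsFrom-pair)
      ... | at-snd p≡j τp≡i = subst₂ SumGrows (sym p≡j) (sym τp≡i)
              (subst₂ ℕ._≤_ (ℕₚ.+-comm (inversionsFrom X i) _) (ℕₚ.+-comm (inversionsFrom Y i) _)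
                (ℕₚ.<⇒≤ inversionsFrom-pair))
      ... | elsewhere p≢i p≢j τp≡p = subst (SumGrows p) (sym τp≡p) (ℕₚ.+-mono-≤ (single p≢i p≢j) (single p≢i p≢j))
        where
        single : p ≢ i → p ≢ j → inversionsFrom X p ℕ.≤ inversionsFrom Y p
        single p≢i p≢j with Finₚ.<-cmp p i
        ... | tri< p<i _ _ = ℕₚ.≤-reflexive (inversionsFrom-before p<i)
        ... | tri≈ _ p≡i _ = ⊥-elim (p≢i p≡i)
        ... | tri> _ _ i<p = inversionsFrom-after p≢i p≢j i<p

      orbit-< : inversionsFrom X i + inversionsFrom X (τ i) ℕ.< inversionsFrom Y i + inversionsFrom Y (τ i)
      orbit-< = subst (λ q → inversionsFrom X i + inversionsFrom X q ℕ.< inversionsFrom Y i + inversionsFrom Y q)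
                      (sym (transpose-fst i j)) inversionsFrom-pair

      double : ∀ Z → inversions Z + inversions Z ≡ sum (λ p → inversionsFrom Z p + inversionsFrom Z (τ p))
      double Z = trans (cong (inversions Z +_) (sum-transpose i j (inversionsFrom Z)))
                       (sym (∑-distrib-+ (inversionsFrom Z) (inversionsFrom Z ∘ τ)))

    -- Summing the rows p and τ p gives twice the inversion count; the rows i and j
    -- together gain strictly, every other row gains weakly.
    inversions-∘transpose : inversions X ℕ.< inversions (X ∘ transpose i j)
    inversions-∘transpose = ℕₚ.≰⇒> λ Y≤X → ℕₚ.<⇒≱ doubled (ℕₚ.+-mono-≤ Y≤X Y≤X)
      where
      doubled : inversions X + inversions X ℕ.< inversions Y + inversions Y
      doubled = subst₂ ℕ._<_ (sym (double X)) (sym (double Y)) (sum-mono-< _ _ orbit-≤ i orbit-<)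

module _ {a p} {A : Set a} {P : Pred A p} (P? : Decidable P) where

  length-filter-tabulate : ∀ {n} (f : Fin n → A) →
                           length (filter P? (List.tabulate f)) ≡ sum (λ i → indicator (P? (f i)))
  length-filter-tabulate {zero}  f = refl
  length-filter-tabulate {suc n} f with P? (f zero)
  ... | yes _ = cong suc (length-filter-tabulate (f ∘ suc))
  ... | no _  = length-filter-tabulate (f ∘ suc)

  length-filter-++ : ∀ xs ys → length (filter P? (xs ++ ys)) ≡ length (filter P? xs) + length (filter P? ys)
  length-filter-++ xs ys = trans (cong length (filter-++ P? xs ys)) (length-++ (filter P? xs))

module _ {a b p} {A : Set a} {B : Set b} {P : Pred (A × B) p} (P? : Decidable P) where

  length-filter-cartesianProduct : ∀ {n} (f : Fin n → A) (ys : List B) →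
    length (filter P? (cartesianProduct (List.tabulate f) ys)) ≡ sum (λ i → length (filter P? (map (f i ,_) ys)))
  length-filter-cartesianProduct {zero}  f ys = refl
  length-filter-cartesianProduct {suc n} f ys =
    trans (length-filter-++ P? (map (f zero ,_) ys) _)
          (cong (length (filter P? (map (f zero ,_) ys)) +_) (length-filter-cartesianProduct (f ∘ suc) ys))

len≡inversions : ∀ {n} (x : Perm n) → len x ≡ inversions (x ⟨_⟩)
len≡inversions {n} x = trans (length-filter-cartesianProduct P? id (allFin n)) (sum-cong-≗ λ p →
    trans (cong (length ∘ filter P?) (map-tabulate id (p ,_))) (length-filter-tabulate P? (p ,_)))
  where
  P? : ∀ pr → Dec (Inversion (x ⟨_⟩) (proj₁ pr) (proj₂ pr))
  P? pr = inversion? (x ⟨_⟩) (proj₁ pr) (proj₂ pr)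

Swapped : ∀ {n} → Transp n → Perm n → Perm n → Set
Swapped t x y = ∀ k → y ⟨ k ⟩ ≡ swap t (x ⟨ k ⟩)

Swapped-sym : ∀ {n} {t : Transp n} (x y : Perm n) → Swapped t x y → Swapped t y x
Swapped-sym {t = t} x y y≡tx k = sym (trans (cong (swap t) (y≡tx k)) (swap-involutive t (x ⟨ k ⟩)))

swap-len-< : ∀ {n} {t : Transp n} (x y : Perm n) {i j} → x ⟨ i ⟩ ≡ fst t → x ⟨ j ⟩ ≡ snd t →
             Swapped t x y → i Fin.< j → len x ℕ.< len y
swap-len-< {t = t} x y {i} {j} xi≡a xj≡b y≡tx i<j =
  subst₂ ℕ._<_ (sym (len≡inversions x)) (trans (inversions-cong x∘τ≡y) (sym (len≡inversions y)))
    (inversions-∘transpose (x ⟨_⟩) i<j (subst₂ Fin._<_ (sym xi≡a) (sym xj≡b) (fst<snd t)))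
  where
  x∘τ≡y : ∀ k → x ⟨ transpose i j k ⟩ ≡ y ⟨ k ⟩
  x∘τ≡y k with transposeView i j k
  ... | at-fst refl e = begin
          x ⟨ transpose k j k ⟩ ≡⟨ cong (x ⟨_⟩) e ⟩
          x ⟨ j ⟩              ≡⟨ xj≡b ⟩
          snd t                ≡⟨ swap-fst t ⟨
          swap t (fst t)       ≡⟨ cong (swap t) xi≡a ⟨
          swap t (x ⟨ k ⟩)     ≡⟨ y≡tx k ⟨
          y ⟨ k ⟩              ∎
    where open ≡-Reasoning
  ... | at-snd refl e = begin
          x ⟨ transpose i k k ⟩ ≡⟨ cong (x ⟨_⟩) e ⟩
          x ⟨ i ⟩              ≡⟨ xi≡a ⟩
          fst t                ≡⟨ swap-snd t ⟨
          swap t (snd t)       ≡⟨ cong (swap t) xj≡b ⟨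
          swap t (x ⟨ k ⟩)     ≡⟨ y≡tx k ⟨
          y ⟨ k ⟩              ∎
    where open ≡-Reasoning
  ... | elsewhere k≢i k≢j e = begin
          x ⟨ transpose i j k ⟩ ≡⟨ cong (x ⟨_⟩) e ⟩
          x ⟨ k ⟩              ≡⟨ swap-elsewhere t (λ xk≡a → k≢i (perm-injective x (trans xk≡a (sym xi≡a))))
                                                   (λ xk≡b → k≢j (perm-injective x (trans xk≡b (sym xj≡b)))) ⟨
          swap t (x ⟨ k ⟩)     ≡⟨ y≡tx k ⟨
          y ⟨ k ⟩              ∎
    where open ≡-Reasoning

swap-len-<⁻¹ : ∀ {n} {t : Transp n} (x y : Perm n) {i j} → x ⟨ i ⟩ ≡ fst t → x ⟨ j ⟩ ≡ snd t →
               Swapped t x y → len x ℕ.< len y → i Fin.< j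
swap-len-<⁻¹ {t = t} x y {i} {j} xi≡a xj≡b y≡tx x<y with Finₚ.<-cmp i j
... | tri< i<j _ _ = i<j
... | tri≈ _ refl _ = ⊥-elim (fst≢snd t (trans (sym xi≡a) xj≡b))
... | tri> _ _ j<i = ⊥-elim (ℕₚ.<-asym x<y (swap-len-< y x yj≡a yi≡b (Swapped-sym x y y≡tx) j<i))
  where
  yj≡a : y ⟨ j ⟩ ≡ fst t
  yj≡a = trans (y≡tx j) (trans (cong (swap t) xj≡b) (swap-snd t))
  yi≡b : y ⟨ i ⟩ ≡ snd t
  yi≡b = trans (y≡tx i) (trans (cong (swap t) xi≡a) (swap-fst t))

-- Paths and flips

vec-≡ : ∀ {a} {A : Set a} {n} {xs ys : Vec A n} → (∀ k → lookup xs k ≡ lookup ys k) → xs ≡ ys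
vec-≡ {xs = xs} {ys} xs≗ys = trans (sym (tabulate∘lookup xs)) (trans (tabulate-cong xs≗ys) (tabulate∘lookup ys))

perm-≡ : ∀ {n} {x y : Perm n} → (∀ k → x ⟨ k ⟩ ≡ y ⟨ k ⟩) → x ≡ y
perm-≡ {x = perm v _} {perm w _} v≗w with vec-≡ {xs = v} {w} v≗w
... | refl = refl

transp-≡ : ∀ {n} {s t : Transp n} → fst s ≡ fst t → snd s ≡ snd t → s ≡ t
transp-≡ {s = tr a b _} {tr .a .b _} refl refl = refl

path-≡ : ∀ {n h} {Γ Δ : Path n h} →
         (∀ k → lookup (verts Γ) k ≡ lookup (verts Δ) k) → (∀ k → lookup (labs Γ) k ≡ lookup (labs Δ) k) → Γ ≡ Δ
path-≡ {Γ = path v l _} {path v′ l′ _} v≗v′ l≗l′ with vec-≡ {xs = v} {v′} v≗v′ | vec-≡ {xs = l} {l′} l≗l′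
... | refl | refl = refl

perm-surjective : ∀ {n} (x : Perm n) v → ∃ λ i → x ⟨ i ⟩ ≡ v
perm-surjective {suc n} x v with any? (λ i → x ⟨ i ⟩ ≟ v)
... | yes found = found
... | no ¬found = ⊥-elim (ℕₚ.1+n≰n (injective⇒≤ (perm-injective x ∘ punchOut-injective v≢x v≢x)))
  where
  v≢x : ∀ {i} → v ≢ x ⟨ i ⟩
  v≢x {i} v≡xi = ¬found (i , sym v≡xi)

edge? : ∀ {n} (x : Perm n) t y → Dec (Edge x t y)
edge? x t y = all? (λ k → y ⟨ k ⟩ ≟ swap t (x ⟨ k ⟩)) ×-dec (len x ℕ.<? len y)

path-edge : ∀ {n h} (Γ : Path n h) (k : Fin h) →
            Edge (lookup (verts Γ) (inject₁ k)) (lookup (labs Γ) k) (lookup (verts Γ) (suc k))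
path-edge (path v l edges) k = recompute (edge? (lookup v (inject₁ k)) (lookup l k) (lookup v (suc k))) (edges k)

edge-cong : ∀ {n} {x x′ y y′ : Perm n} {t t′} → x ≡ x′ → t ≡ t′ → y ≡ y′ → Edge x t y → Edge x′ t′ y′
edge-cong refl refl refl e = e

transp-unique : ∀ {n} {s t : Transp n} {a b} → a ≢ b → swap s a ≡ b → swap t b ≡ a → s ≡ t
transp-unique {s = s} {t} {a} {b} a≢b sa≡b tb≡a with swapView s a | swapView t b
... | at-fst a≡s₁ sa≡s₂ | at-fst b≡t₁ tb≡t₂ = ⊥-elim (Finₚ.<-asym
      (subst₂ Fin._<_ (sym a≡s₁) (trans (sym sa≡s₂) sa≡b) (fst<snd s))
      (subst₂ Fin._<_ (sym b≡t₁) (trans (sym tb≡t₂) tb≡a) (fst<snd t)))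
... | at-fst a≡s₁ sa≡s₂ | at-snd b≡t₂ tb≡t₁ =
      transp-≡ (trans (sym a≡s₁) (trans (sym tb≡a) tb≡t₁)) (trans (sym sa≡s₂) (trans sa≡b b≡t₂))
... | at-snd a≡s₂ sa≡s₁ | at-fst b≡t₁ tb≡t₂ =
      transp-≡ (trans (sym sa≡s₁) (trans sa≡b b≡t₁)) (trans (sym a≡s₂) (trans (sym tb≡a) tb≡t₂))
... | at-snd a≡s₂ sa≡s₁ | at-snd b≡t₂ tb≡t₁ = ⊥-elim (Finₚ.<-asym
      (subst₂ Fin._<_ (trans (sym sa≡s₁) sa≡b) (sym a≡s₂) (fst<snd s))
      (subst₂ Fin._<_ (trans (sym tb≡t₁) tb≡a) (sym b≡t₂) (fst<snd t)))
... | elsewhere _ _ sa≡a | _ = ⊥-elim (a≢b (trans (sym sa≡a) sa≡b))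
... | _ | elsewhere _ _ tb≡b = ⊥-elim (a≢b (trans (sym tb≡a) tb≡b))

inject₁≢suc : ∀ {n} (i : Fin n) → inject₁ i ≢ suc i
inject₁≢suc i = Finₚ.<⇒≢ (≤̄⇒inject₁< Finₚ.≤-refl)

flipped-vertex-between : ∀ {n h} {Γ Γ′ : Path n h} {k} → Interior k → Flip k Γ Γ′ →
  ∃₂ λ i j → ∃₂ λ s t →
    Edge (lookup (verts Γ) i) s (lookup (verts Γ′) k) × Edge (lookup (verts Γ′) k) t (lookup (verts Γ) j)
flipped-vertex-between {h = h} {Γ} {Γ′} {suc e} (_ , k<h) (same , _) =
  inject₁ e , suc e′ , l′ e , l′ e′ ,
  subst (λ x → Edge x (l′ e) (v′ (suc e))) (sym (same (inject₁ e) (inject₁≢suc e))) (path-edge Γ′ e) ,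
  subst₂ (λ x y → Edge x (l′ e′) y) (cong v′ e′-source) (sym (same (suc e′) e′-target≢k)) (path-edge Γ′ e′)
  where
  v′ = lookup (verts Γ′)
  l′ = lookup (labs Γ′)
  e′ : Fin h
  e′ = lower₁ (suc e) (ℕₚ.<⇒≢ k<h ∘ sym)
  e′-source : inject₁ e′ ≡ suc e
  e′-source = inject₁-lower₁ (suc e) _
  e′-target≢k : suc e′ ≢ suc e
  e′-target≢k e′+1≡k = inject₁≢suc e′ (trans e′-source (sym e′+1≡k))

-- Deleting a value that stays at a fixed position

punchOut-mono-< : ∀ {n} {i j k : Fin (suc n)} (i≢j : i ≢ j) (i≢k : i ≢ k) → j Fin.< k → punchOut i≢j Fin.< punchOut i≢k
punchOut-mono-< i≢j i≢k j<k = ℕₚ.≰⇒> (ℕₚ.<⇒≱ j<k ∘ punchOut-cancel-≤ i≢k i≢j)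

punchIn-mono-< : ∀ {n} i {j k : Fin n} → j Fin.< k → punchIn i j Fin.< punchIn i k
punchIn-mono-< i {j} {k} j<k = ℕₚ.≰⇒> (ℕₚ.<⇒≱ j<k ∘ punchIn-cancel-≤ i k j)

punchIn-cancel-< : ∀ {n} i {j k : Fin n} → punchIn i j Fin.< punchIn i k → j Fin.< k
punchIn-cancel-< i {j} {k} j<k = ℕₚ.≰⇒> (ℕₚ.<⇒≱ j<k ∘ punchIn-mono-≤ i k j)

punchIn≢ : ∀ {n} i (j : Fin n) → i ≢ punchIn i j
punchIn≢ i j = punchInᵢ≢i i j ∘ sym

data PunchInView {n} (i : Fin (suc n)) : Fin (suc n) → Set where
  at        : PunchInView i i
  punchedIn : ∀ j → PunchInView i (punchIn i j)

punchInView : ∀ {n} i (r : Fin (suc n)) → PunchInView i r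
punchInView i r with i ≟ r
... | yes refl = at
... | no i≢r = subst (PunchInView i) (punchIn-punchOut i≢r) (punchedIn _)

-- delete x removes the point (q, c) from the graph of x and standardises what is left.
module Deletion {n : ℕ} (c q : Fin (suc n)) where

  Pinned : Perm (suc n) → Set
  Pinned x = x ⟨ q ⟩ ≡ c

  c≢elsewhere : ∀ x → .(Pinned x) → ∀ p → c ≢ x ⟨ punchIn q p ⟩
  c≢elsewhere x pinned p = ¬-recompute λ c≡x → punchIn≢ q p (perm-injective x (trans pinned c≡x))

  delete : (x : Perm (suc n)) → .(Pinned x) → Perm n
  delete x pinned = perm (tabulate value) λ i j e → punchIn-injective q i j (perm-injective x
      (punchOut-injective (c≢elsewhere x pinned i) (c≢elsewhere x pinned j)
        (trans (sym (lookup∘tabulate value i)) (trans e (lookup∘tabulate value j)))))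
    where
    value : Fin n → Fin n
    value p = punchOut (c≢elsewhere x pinned p)

  delete-⟨⟩ : ∀ x .(pinned : Pinned x) p → delete x pinned ⟨ p ⟩ ≡ punchOut (c≢elsewhere x pinned p)
  delete-⟨⟩ x pinned = lookup∘tabulate _

  punchIn-delete : ∀ x .(pinned : Pinned x) p → punchIn c (delete x pinned ⟨ p ⟩) ≡ x ⟨ punchIn q p ⟩
  punchIn-delete x pinned p = trans (cong (punchIn c) (delete-⟨⟩ x pinned p)) (punchIn-punchOut _)

  private
    insertValue : Perm n → (r : Fin (suc n)) → Dec (q ≡ r) → Fin (suc n)
    insertValue y r (yes _)   = c
    insertValue y r (no q≢r) = punchIn c (y ⟨ punchOut q≢r ⟩)

    insertAt : Perm n → Fin (suc n) → Fin (suc n)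
    insertAt y r = insertValue y r (q ≟ r)

    insertAt-q : ∀ y → insertAt y q ≡ c
    insertAt-q y with q ≟ q
    ... | yes _ = refl
    ... | no q≢q = ⊥-elim (q≢q refl)

    insertAt-punchIn : ∀ y p → insertAt y (punchIn q p) ≡ punchIn c (y ⟨ p ⟩)
    insertAt-punchIn y p with q ≟ punchIn q p
    ... | yes q≡q′ = ⊥-elim (punchIn≢ q p q≡q′)
    ... | no q≢q′ = cong (λ p′ → punchIn c (y ⟨ p′ ⟩)) (punchOut-punchIn q)

    insertAt-injective : ∀ y {i j} → insertAt y i ≡ insertAt y j → i ≡ j
    insertAt-injective y {i} {j} e with punchInView q i | punchInView q j
    ... | at | at = refl
    ... | at | punchedIn p = ⊥-elim (punchIn≢ c (y ⟨ p ⟩) (trans (sym (insertAt-q y)) (trans e (insertAt-punchIn y p))))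
    ... | punchedIn p | at = ⊥-elim (punchIn≢ c (y ⟨ p ⟩) (trans (sym (insertAt-q y)) (trans (sym e) (insertAt-punchIn y p))))
    ... | punchedIn p | punchedIn p′ = cong (punchIn q) (perm-injective y (punchIn-injective c _ _
            (trans (sym (insertAt-punchIn y p)) (trans e (insertAt-punchIn y p′)))))

  insert : Perm n → Perm (suc n)
  insert y = perm (tabulate (insertAt y)) λ i j e → insertAt-injective y
    (trans (sym (lookup∘tabulate (insertAt y) i)) (trans e (lookup∘tabulate (insertAt y) j)))

  insert-pinned : ∀ y → Pinned (insert y)
  insert-pinned y = trans (lookup∘tabulate (insertAt y) q) (insertAt-q y)

  insert-punchIn : ∀ y p → insert y ⟨ punchIn q p ⟩ ≡ punchIn c (y ⟨ p ⟩)
  insert-punchIn y p = trans (lookup∘tabulate (insertAt y) (punchIn q p)) (insertAt-punchIn y p)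

  insert-delete : ∀ x .(pinned : Pinned x) → insert (delete x pinned) ≡ x
  insert-delete x pinned = perm-≡ λ r → agree r (punchInView q r)
    where
    agree : ∀ r → PunchInView q r → insert (delete x pinned) ⟨ r ⟩ ≡ x ⟨ r ⟩
    agree _ at = trans (insert-pinned _) (sym (recompute (x ⟨ q ⟩ ≟ c) pinned))
    agree _ (punchedIn p) = trans (insert-punchIn _ p) (punchIn-delete x pinned p)

  delete-insert : ∀ y .(pinned : Pinned (insert y)) → delete (insert y) pinned ≡ y
  delete-insert y pinned = perm-≡ λ p → punchIn-injective c _ _
    (trans (punchIn-delete (insert y) pinned p) (insert-punchIn y p))

  delete-injective : ∀ {x y} .{px : Pinned x} .{py : Pinned y} → delete x px ≡ delete y py → x ≡ y
  delete-injective {x} {y} {px} {py} dx≡dy =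
    trans (sym (insert-delete x px)) (trans (cong insert dx≡dy) (insert-delete y py))

  delete-cong : ∀ {x y} .{px : Pinned x} .{py : Pinned y} → x ≡ y → delete x px ≡ delete y py
  delete-cong refl = refl

  Avoids : Transp (suc n) → Set
  Avoids t = c ≢ fst t × c ≢ snd t

  c≢fst : ∀ t → .(Avoids t) → c ≢ fst t
  c≢fst t avoids = ¬-recompute (proj₁ avoids)

  c≢snd : ∀ t → .(Avoids t) → c ≢ snd t
  c≢snd t avoids = ¬-recompute (proj₂ avoids)

  deleteT : (t : Transp (suc n)) → .(Avoids t) → Transp n
  deleteT t avoids = tr (punchOut (c≢fst t avoids)) (punchOut (c≢snd t avoids))
    (punchOut-mono-< (c≢fst t avoids) (c≢snd t avoids) (fst<snd t))

  insertT : Transp n → Transp (suc n)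
  insertT s = tr (punchIn c (fst s)) (punchIn c (snd s)) (punchIn-mono-< c (fst<snd s))

  insertT-avoids : ∀ s → Avoids (insertT s)
  insertT-avoids s = punchIn≢ c (fst s) , punchIn≢ c (snd s)

  insertT-deleteT : ∀ t .(avoids : Avoids t) → insertT (deleteT t avoids) ≡ t
  insertT-deleteT t avoids = transp-≡ (punchIn-punchOut _) (punchIn-punchOut _)

  deleteT-insertT : ∀ s .(avoids : Avoids (insertT s)) → deleteT (insertT s) avoids ≡ s
  deleteT-insertT s avoids = transp-≡ (punchOut-punchIn c) (punchOut-punchIn c)

  deleteT-injective : ∀ {s t} .{αs : Avoids s} .{αt : Avoids t} → deleteT s αs ≡ deleteT t αt → s ≡ t
  deleteT-injective {s} {t} {αs} {αt} ds≡dt =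
    trans (sym (insertT-deleteT s αs)) (trans (cong insertT ds≡dt) (insertT-deleteT t αt))

  deleteT-cong : ∀ {s t} .{αs : Avoids s} .{αt : Avoids t} → s ≡ t → deleteT s αs ≡ deleteT t αt
  deleteT-cong refl = refl

  deleteT-mono : ∀ {s t} .(αs : Avoids s) .(αt : Avoids t) → s ≺ t → deleteT s αs ≺ deleteT t αt
  deleteT-mono {s} {t} αs αt (inj₁ a<a′) = inj₁ (punchOut-mono-< (c≢fst s αs) (c≢fst t αt) a<a′)
  deleteT-mono {s} {t} αs αt (inj₂ (a≡a′ , b<b′)) = inj₂ (punchOut-cong c a≡a′ , punchOut-mono-< (c≢snd s αs) (c≢snd t αt) b<b′)

  punchIn-swap : ∀ s v → punchIn c (swap s v) ≡ swap (insertT s) (punchIn c v)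
  punchIn-swap s v with swapView s v
  ... | at-fst refl e = trans (cong (punchIn c) e) (sym (swap-fst (insertT s)))
  ... | at-snd refl e = trans (cong (punchIn c) e) (sym (swap-snd (insertT s)))
  ... | elsewhere v≢a v≢b e = trans (cong (punchIn c) e) (sym (swap-elsewhere (insertT s)
          (v≢a ∘ punchIn-injective c _ _) (v≢b ∘ punchIn-injective c _ _)))

  swap-avoided : ∀ {t} → Avoids t → swap t c ≡ c
  swap-avoided (c≢a , c≢b) = swap-elsewhere _ c≢a c≢b

  swapped-avoids : ∀ {t} x y → Pinned x → Pinned y → Swapped t x y → Avoids t
  swapped-avoids {t} x y px py y≡tx with swapView t c
  ... | at-fst c≡a tc≡b = ⊥-elim (fst≢snd t (trans (sym c≡a) (trans (sym tc≡c) tc≡b)))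
    where tc≡c = trans (cong (swap t) (sym px)) (trans (sym (y≡tx q)) py)
  ... | at-snd c≡b tc≡a = ⊥-elim (fst≢snd t (trans (sym tc≡a) (trans tc≡c c≡b)))
    where tc≡c = trans (cong (swap t) (sym px)) (trans (sym (y≡tx q)) py)
  ... | elsewhere c≢a c≢b _ = (c≢a , c≢b)

  delete-swapped : ∀ {t} x y .(avoids : Avoids t) (px : Pinned x) (py : Pinned y) → Swapped t x y →
                   Swapped (deleteT t avoids) (delete x px) (delete y py)
  delete-swapped {t} x y avoids px py y≡tx p = punchIn-injective c _ _ (begin
      punchIn c (delete y py ⟨ p ⟩)                  ≡⟨ punchIn-delete y py p ⟩
      y ⟨ punchIn q p ⟩                               ≡⟨ y≡tx (punchIn q p) ⟩
      swap t (x ⟨ punchIn q p ⟩)                      ≡⟨ cong (swap t) (punchIn-delete x px p) ⟨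
      swap t (punchIn c (delete x px ⟨ p ⟩))          ≡⟨ cong (λ s → swap s (punchIn c (delete x px ⟨ p ⟩))) (insertT-deleteT t avoids) ⟨
      swap (insertT t′) (punchIn c (delete x px ⟨ p ⟩)) ≡⟨ punchIn-swap t′ (delete x px ⟨ p ⟩) ⟨
      punchIn c (swap t′ (delete x px ⟨ p ⟩))         ∎)
    where
    open ≡-Reasoning
    t′ = deleteT t avoids

  insert-swapped : ∀ {s} y y′ → Swapped s y y′ → Swapped (insertT s) (insert y) (insert y′)
  insert-swapped {s} y y′ y′≡sy r with punchInView q r
  ... | at = trans (insert-pinned y′)
                   (sym (trans (cong (swap (insertT s)) (insert-pinned y)) (swap-avoided (insertT-avoids s))))
  ... | punchedIn p = begin
      insert y′ ⟨ punchIn q p ⟩                 ≡⟨ insert-punchIn y′ p ⟩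
      punchIn c (y′ ⟨ p ⟩)                      ≡⟨ cong (punchIn c) (y′≡sy p) ⟩
      punchIn c (swap s (y ⟨ p ⟩))              ≡⟨ punchIn-swap s (y ⟨ p ⟩) ⟩
      swap (insertT s) (punchIn c (y ⟨ p ⟩))    ≡⟨ cong (swap (insertT s)) (insert-punchIn y p) ⟨
      swap (insertT s) (insert y ⟨ punchIn q p ⟩) ∎
    where open ≡-Reasoning

  private
    position-of : ∀ x → Pinned x → ∀ {v} → c ≢ v → ∃ λ i → x ⟨ punchIn q i ⟩ ≡ v
    position-of x px {v} c≢v with perm-surjective x v
    ... | i , xi≡v with punchInView q i
    ...   | at = ⊥-elim (c≢v (trans (sym px) xi≡v))
    ...   | punchedIn i′ = i′ , xi≡v

  module _ {t x y} (avoids : Avoids t) (px : Pinned x) (py : Pinned y) (y≡tx : Swapped t x y) where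

    private
      t′ = deleteT t avoids
      i = proj₁ (position-of x px (proj₁ avoids))
      j = proj₁ (position-of x px (proj₂ avoids))
      xi≡a : x ⟨ punchIn q i ⟩ ≡ fst t
      xi≡a = proj₂ (position-of x px (proj₁ avoids))
      xj≡b : x ⟨ punchIn q j ⟩ ≡ snd t
      xj≡b = proj₂ (position-of x px (proj₂ avoids))
      x′i≡a′ : delete x px ⟨ i ⟩ ≡ fst t′
      x′i≡a′ = punchIn-injective c _ _ (trans (punchIn-delete x px i) (trans xi≡a (sym (punchIn-punchOut _))))
      x′j≡b′ : delete x px ⟨ j ⟩ ≡ snd t′
      x′j≡b′ = punchIn-injective c _ _ (trans (punchIn-delete x px j) (trans xj≡b (sym (punchIn-punchOut _))))

    delete-len-< : len x ℕ.< len y → len (delete x px) ℕ.< len (delete y py)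
    delete-len-< x<y = swap-len-< (delete x px) (delete y py) x′i≡a′ x′j≡b′ (delete-swapped x y avoids px py y≡tx)
      (punchIn-cancel-< q (swap-len-<⁻¹ x y xi≡a xj≡b y≡tx x<y))

    delete-len-<⁻¹ : len (delete x px) ℕ.< len (delete y py) → len x ℕ.< len y
    delete-len-<⁻¹ x′<y′ = swap-len-< x y xi≡a xj≡b y≡tx
      (punchIn-mono-< q (swap-len-<⁻¹ (delete x px) (delete y py) x′i≡a′ x′j≡b′ (delete-swapped x y avoids px py y≡tx) x′<y′))

  delete-edge : ∀ {t} x y (px : Pinned x) (py : Pinned y) → Edge x t y →
                Σ (Avoids t) λ avoids → Edge (delete x px) (deleteT t avoids) (delete y py)
  delete-edge x y px py (y≡tx , x<y) =
    avoids , delete-swapped x y avoids px py y≡tx , delete-len-< {x = x} {y} avoids px py y≡tx x<y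
    where avoids = swapped-avoids x y px py y≡tx

  insert-edge : ∀ {s} y y′ → Edge y s y′ → Edge (insert y) (insertT s) (insert y′)
  insert-edge {s} y y′ (y′≡sy , y<y′) = insert-swapped y y′ y′≡sy ,
    delete-len-<⁻¹ {x = insert y} {insert y′} (insertT-avoids s) (insert-pinned y) (insert-pinned y′) (insert-swapped y y′ y′≡sy)
      (subst₂ (λ a b → len a ℕ.< len b) (sym (delete-insert y (insert-pinned y))) (sym (delete-insert y′ (insert-pinned y′))) y<y′)

  -- If y moved c, both edges would be labelled by the transposition of c and y(q),
  -- so z = x, contradicting the increasing lengths.
  pinned-between : ∀ {s t} x y z → Pinned x → Pinned z → Edge x s y → Edge y t z → Pinned y
  pinned-between {s} {t} x y z px pz (y≡sx , x<y) (z≡ty , y<z) with c ≟ y ⟨ q ⟩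
  ... | yes c≡y = sym c≡y
  ... | no c≢y = ⊥-elim (ℕₚ.<-irrefl (cong len (sym z≡x)) (ℕₚ.<-trans x<y y<z))
    where
    s≡t : s ≡ t
    s≡t = transp-unique c≢y (trans (cong (swap s) (sym px)) (sym (y≡sx q))) (trans (sym (z≡ty q)) pz)
    z≡x : z ≡ x
    z≡x = perm-≡ λ k → begin
      z ⟨ k ⟩                   ≡⟨ z≡ty k ⟩
      swap t (y ⟨ k ⟩)          ≡⟨ cong (swap t) (y≡sx k) ⟩
      swap t (swap s (x ⟨ k ⟩)) ≡⟨ cong (λ s → swap t (swap s (x ⟨ k ⟩))) s≡t ⟩
      swap t (swap t (x ⟨ k ⟩)) ≡⟨ swap-involutive t (x ⟨ k ⟩) ⟩
      x ⟨ k ⟩                   ∎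
      where open ≡-Reasoning

  AllPinned : ∀ {h} → Path (suc n) h → Set
  AllPinned Γ = ∀ k → Pinned (lookup (verts Γ) k)

  flip-AllPinned : ∀ {h} {Γ Γ′ : Path (suc n) h} → FlipStep Γ Γ′ → AllPinned Γ → AllPinned Γ′
  flip-AllPinned {Γ = Γ} {Γ′} (k , interior , flip) pinned j with j ≟ k
  ... | no j≢k = subst Pinned (proj₁ flip j j≢k) (pinned j)
  ... | yes refl with flipped-vertex-between {Γ = Γ} {Γ′} interior flip
  ...   | i , i′ , _ , _ , into , out-of = pinned-between (lookup (verts Γ) i) (lookup (verts Γ′) j) (lookup (verts Γ) i′) (pinned i) (pinned i′) into out-of

  star-AllPinned : ∀ {h} {Γ Γ′ : Path (suc n) h} → Star FlipStep Γ Γ′ → AllPinned Γ → AllPinned Γ′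
  star-AllPinned ε = id
  star-AllPinned {Γ = Γ} (_◅_ {j = Γ₁} step steps) = star-AllPinned steps ∘ flip-AllPinned {Γ = Γ} {Γ₁} step

  AllPinned-from-start : ∀ {h} (Γ : Path (suc n) h) → (∀ k → Avoids (lookup (labs Γ) k)) →
                         Pinned (lookup (verts Γ) zero) → AllPinned Γ
  AllPinned-from-start Γ avoids pinned₀ = <-weakInduction (Pinned ∘ lookup (verts Γ)) pinned₀ λ k pinned →
    trans (proj₁ (path-edge Γ k) q) (trans (cong (swap (lookup (labs Γ) k)) pinned) (swap-avoided (avoids k)))

  label-avoids : ∀ {h} (Γ : Path (suc n) h) → AllPinned Γ → ∀ k → Avoids (lookup (labs Γ) k)
  label-avoids Γ pinned k = proj₁ (delete-edge (lookup (verts Γ) (inject₁ k)) (lookup (verts Γ) (suc k)) (pinned (inject₁ k)) (pinned (suc k)) (path-edge Γ k))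

  deletePath : ∀ {h} (Γ : Path (suc n) h) → .(AllPinned Γ) → Path n h
  deletePath Γ pinned = path (tabulate vertex) (tabulate label) λ k →
      edge-cong (sym (lookup∘tabulate vertex (inject₁ k))) (sym (lookup∘tabulate label k)) (sym (lookup∘tabulate vertex (suc k)))
        (proj₂ (delete-edge (lookup (verts Γ) (inject₁ k)) (lookup (verts Γ) (suc k)) (pinned (inject₁ k)) (pinned (suc k)) (path-edge Γ k)))
    where
    vertex = λ k → delete (lookup (verts Γ) k) (pinned k)
    label = λ k → deleteT (lookup (labs Γ) k) (label-avoids Γ pinned k)

  deletePath-vertex : ∀ {h} (Γ : Path (suc n) h) .(pinned : AllPinned Γ) k →
                      lookup (verts (deletePath Γ pinned)) k ≡ delete (lookup (verts Γ) k) (pinned k)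
  deletePath-vertex Γ pinned = lookup∘tabulate _

  deletePath-label : ∀ {h} (Γ : Path (suc n) h) .(pinned : AllPinned Γ) k →
                     lookup (labs (deletePath Γ pinned)) k ≡ deleteT (lookup (labs Γ) k) (label-avoids Γ pinned k)
  deletePath-label Γ pinned = lookup∘tabulate _

  insertPath : ∀ {h} → Path n h → Path (suc n) h
  insertPath Δ = path (tabulate vertex) (tabulate label) λ k →
      edge-cong (sym (lookup∘tabulate vertex (inject₁ k))) (sym (lookup∘tabulate label k)) (sym (lookup∘tabulate vertex (suc k)))
        (insert-edge (lookup (verts Δ) (inject₁ k)) (lookup (verts Δ) (suc k)) (path-edge Δ k))
    where
    vertex = λ k → insert (lookup (verts Δ) k)
    label = λ k → insertT (lookup (labs Δ) k)

  insertPath-vertex : ∀ {h} (Δ : Path n h) k → lookup (verts (insertPath Δ)) k ≡ insert (lookup (verts Δ) k)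
  insertPath-vertex Δ = lookup∘tabulate _

  insertPath-label : ∀ {h} (Δ : Path n h) k → lookup (labs (insertPath Δ)) k ≡ insertT (lookup (labs Δ) k)
  insertPath-label Δ = lookup∘tabulate _

  deletePath-insertPath : ∀ {h} (Δ : Path n h) .(pinned : AllPinned (insertPath Δ)) → deletePath (insertPath Δ) pinned ≡ Δ
  deletePath-insertPath Δ pinned = path-≡
    (λ k → trans (deletePath-vertex (insertPath Δ) pinned k)
                 (trans (delete-cong {px = pinned k} {py = insert-pinned (lookup (verts Δ) k)} (insertPath-vertex Δ k)) (delete-insert (lookup (verts Δ) k) (insert-pinned (lookup (verts Δ) k)))))
    (λ k → trans (deletePath-label (insertPath Δ) pinned k)
                 (trans (deleteT-cong {αs = label-avoids (insertPath Δ) pinned k} {αt = insertT-avoids (lookup (labs Δ) k)} (insertPath-label Δ k))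
                        (deleteT-insertT (lookup (labs Δ) k) (insertT-avoids (lookup (labs Δ) k)))))

  insertPath-deletePath : ∀ {h} (Γ : Path (suc n) h) .(pinned : AllPinned Γ) → insertPath (deletePath Γ pinned) ≡ Γ
  insertPath-deletePath Γ pinned = path-≡
    (λ k → trans (insertPath-vertex (deletePath Γ pinned) k) (trans (cong insert (deletePath-vertex Γ pinned k)) (insert-delete (lookup (verts Γ) k) (pinned k))))
    (λ k → trans (insertPath-label (deletePath Γ pinned) k) (trans (cong insertT (deletePath-label Γ pinned k)) (insertT-deleteT (lookup (labs Γ) k) (label-avoids Γ pinned k))))

  deletePath-injective : ∀ {h} {Γ Γ′ : Path (suc n) h} .{p : AllPinned Γ} .{p′ : AllPinned Γ′} →
                         deletePath Γ p ≡ deletePath Γ′ p′ → Γ ≡ Γ′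
  deletePath-injective {Γ = Γ} {Γ′} {p} {p′} e =
    trans (sym (insertPath-deletePath Γ p)) (trans (cong insertPath e) (insertPath-deletePath Γ′ p′))

  insert-injective : ∀ {y y′} → insert y ≡ insert y′ → y ≡ y′
  insert-injective {y} {y′} e =
    trans (sym (delete-insert y (insert-pinned y))) (trans (delete-cong {px = insert-pinned y} {py = insert-pinned y′} e) (delete-insert y′ (insert-pinned y′)))

  deletePath-flip : ∀ {h} (Γ Γ′ : Path (suc n) h) .(p : AllPinned Γ) .(p′ : AllPinned Γ′) {k} →
                    Flip k Γ Γ′ → Flip k (deletePath Γ p) (deletePath Γ′ p′)
  deletePath-flip Γ Γ′ p p′ {k} (same , differ) =
    (λ j j≢k → trans (deletePath-vertex Γ p j)
                     (trans (delete-cong {px = p j} {py = p′ j} (same j j≢k)) (sym (deletePath-vertex Γ′ p′ j)))) ,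
    (λ e → differ (delete-injective {px = p k} {py = p′ k}
                     (trans (sym (deletePath-vertex Γ p k)) (trans e (deletePath-vertex Γ′ p′ k)))))

  insertPath-flip : ∀ {h} (Δ Δ′ : Path n h) {k} → Flip k Δ Δ′ → Flip k (insertPath Δ) (insertPath Δ′)
  insertPath-flip Δ Δ′ {k} (same , differ) =
    (λ j j≢k → trans (insertPath-vertex Δ j) (trans (cong insert (same j j≢k)) (sym (insertPath-vertex Δ′ j)))) ,
    (λ e → differ (insert-injective (trans (sym (insertPath-vertex Δ k)) (trans e (insertPath-vertex Δ′ k)))))

  deletePath-star : ∀ {h} {Γ Γ′ : Path (suc n) h} (steps : Star FlipStep Γ Γ′) (p : AllPinned Γ) →
                    Star FlipStep (deletePath Γ p) (deletePath Γ′ (star-AllPinned steps p))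
  deletePath-star ε p = ε
  deletePath-star {Γ = Γ} (_◅_ {j = Γ₁} (k , interior , flip) steps) p =
    (k , interior , deletePath-flip Γ Γ₁ p p₁ flip) ◅ deletePath-star steps p₁
    where p₁ = flip-AllPinned {Γ = Γ} {Γ₁} (k , interior , flip) p

  insertPath-star : ∀ {h} {Δ Δ′ : Path n h} → Star FlipStep Δ Δ′ → Star FlipStep (insertPath Δ) (insertPath Δ′)
  insertPath-star = gmap insertPath λ {Δ} {Δ′} (k , interior , flip) → k , interior , insertPath-flip Δ Δ′ flip

  module _ {h} (Γ₀ : Path (suc n) h) (pinned₀ : AllPinned Γ₀) where

    private
      inF-pinned : ∀ {Γ} → InF Γ₀ Γ → AllPinned Γ
      inF-pinned steps = star-AllPinned steps pinned₀

      inV-pinned : ∀ {x} → InV Γ₀ x → Pinned x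
      inV-pinned (_ , steps , k , refl) = inF-pinned steps k

      inL-avoids : ∀ {t} → InL Γ₀ t → Avoids t
      inL-avoids (Γ , steps , k , refl) = label-avoids Γ (inF-pinned steps) k

      lift : ∀ {Δ} → InF (deletePath Γ₀ pinned₀) Δ → InF Γ₀ (insertPath Δ)
      lift steps = subst (λ Γ → Star FlipStep Γ _) (insertPath-deletePath Γ₀ pinned₀) (insertPath-star steps)

    deletion-iso : Iso Γ₀ (deletePath Γ₀ pinned₀)
    deletion-iso = record
      { f       = λ x p → delete x (inV-pinned p)
      ; f-into  = λ { x (Γ , steps , k , refl) →
                    deletePath Γ (inF-pinned steps) , deletePath-star steps pinned₀ , k , deletePath-vertex Γ (inF-pinned steps) k }
      ; f-inj   = λ x y p p′ → delete-injective {px = inV-pinned p} {py = inV-pinned p′}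
      ; f-surj  = λ { y (Δ , steps , k , refl) →
                    lookup (verts (insertPath Δ)) k , (insertPath Δ , lift steps , k , refl) ,
                    trans (delete-cong {px = inF-pinned (lift steps) k} {py = insert-pinned y} (insertPath-vertex Δ k))
                          (delete-insert y (insert-pinned y)) }
      ; φ       = λ Γ p → deletePath Γ (inF-pinned p)
      ; φ-verts = λ Γ p → deletePath-vertex Γ (inF-pinned p)
      ; φ-into  = λ Γ p → deletePath-star p pinned₀
      ; φ-inj   = λ Γ Γ′ p p′ → deletePath-injective {p = inF-pinned p} {p′ = inF-pinned p′}
      ; φ-surj  = λ Δ steps → insertPath Δ , lift steps , deletePath-insertPath Δ (inF-pinned (lift steps))
      ; φ-flip  = λ Γ Γ′ p p′ k _ → deletePath-flip Γ Γ′ (inF-pinned p) (inF-pinned p′)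
      ; g       = λ t p → deleteT t (inL-avoids p)
      ; g-into  = λ { t (Γ , steps , k , refl) →
                    deletePath Γ (inF-pinned steps) , deletePath-star steps pinned₀ , k , deletePath-label Γ (inF-pinned steps) k }
      ; g-inj   = λ s t p p′ → deleteT-injective {αs = inL-avoids p} {αt = inL-avoids p′}
      ; g-surj  = λ { t (Δ , steps , k , refl) →
                    lookup (labs (insertPath Δ)) k , (insertPath Δ , lift steps , k , refl) ,
                    trans (deleteT-cong {αs = label-avoids (insertPath Δ) (inF-pinned (lift steps)) k} {αt = insertT-avoids t}
                                        (insertPath-label Δ k))
                          (deleteT-insertT t (insertT-avoids t)) }
      ; g-labs  = λ Γ p → deletePath-label Γ (inF-pinned p)
      ; g-mono  = λ s t p p′ → deleteT-mono {s} {t} (inL-avoids p) (inL-avoids p′)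
      }

-- Reduction to small symmetric groups

Iso-refl : ∀ {n h} (Γ₀ : Path n h) → Iso Γ₀ Γ₀
Iso-refl Γ₀ = record
  { f = λ x _ → x ; f-into = λ _ p → p ; f-inj = λ _ _ _ _ e → e ; f-surj = λ y p → y , p , refl
  ; φ = λ Γ _ → Γ ; φ-verts = λ _ _ _ → refl ; φ-into = λ _ p → p ; φ-inj = λ _ _ _ _ e → e
  ; φ-surj = λ Δ p → Δ , p , refl ; φ-flip = λ _ _ _ _ _ _ flip → flip
  ; g = λ t _ → t ; g-into = λ _ p → p ; g-inj = λ _ _ _ _ e → e ; g-surj = λ t p → t , p , refl
  ; g-labs = λ _ _ _ → refl ; g-mono = λ _ _ _ _ s≺t → s≺t
  }

Iso-trans : ∀ {n m k h} {Γ₀ : Path n h} {Δ₀ : Path m h} {Θ₀ : Path k h} → Iso Γ₀ Δ₀ → Iso Δ₀ Θ₀ → Iso Γ₀ Θ₀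
Iso-trans {Γ₀ = Γ₀} {Δ₀} {Θ₀} I J = record
  { f       = λ x p → J.f (I.f x p) (I.f-into x p)
  ; f-into  = λ x p → J.f-into _ (I.f-into x p)
  ; f-inj   = λ x y p q e → I.f-inj x y p q (J.f-inj _ _ (I.f-into x p) (I.f-into y q) e)
  ; f-surj  = λ z r → let (y , q , Jy≡z) = J.f-surj z r ; (x , p , Ix≡y) = I.f-surj y q
                      in x , p , trans (J-f-cong Ix≡y) Jy≡z
  ; φ       = λ Γ p → J.φ (I.φ Γ p) (I.φ-into Γ p)
  ; φ-verts = λ Γ p k → trans (J.φ-verts _ (I.φ-into Γ p) k) (J-f-cong (I.φ-verts Γ p k))
  ; φ-into  = λ Γ p → J.φ-into _ (I.φ-into Γ p)
  ; φ-inj   = λ Γ Γ′ p p′ e → I.φ-inj Γ Γ′ p p′ (J.φ-inj _ _ (I.φ-into Γ p) (I.φ-into Γ′ p′) e)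
  ; φ-surj  = λ Θ r → let (Δ , q , JΔ≡Θ) = J.φ-surj Θ r ; (Γ , p , IΓ≡Δ) = I.φ-surj Δ q
                      in Γ , p , trans (J-φ-cong IΓ≡Δ) JΔ≡Θ
  ; φ-flip  = λ Γ Γ′ p p′ k interior flip →
                J.φ-flip _ _ (I.φ-into Γ p) (I.φ-into Γ′ p′) k interior (I.φ-flip Γ Γ′ p p′ k interior flip)
  ; g       = λ t p → J.g (I.g t p) (I.g-into t p)
  ; g-into  = λ t p → J.g-into _ (I.g-into t p)
  ; g-inj   = λ s t p q e → I.g-inj s t p q (J.g-inj _ _ (I.g-into s p) (I.g-into t q) e)
  ; g-surj  = λ u r → let (t , q , Jt≡u) = J.g-surj u r ; (s , p , Is≡t) = I.g-surj t q
                      in s , p , trans (J-g-cong Is≡t) Jt≡u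
  ; g-labs  = λ Γ p k → trans (J.g-labs _ (I.φ-into Γ p) k) (J-g-cong (I.g-labs Γ p k))
  ; g-mono  = λ s t p q s≺t → J.g-mono _ _ (I.g-into s p) (I.g-into t q) (I.g-mono s t p q s≺t)
  }
  where
  module I = Iso I
  module J = Iso J
  J-f-cong : ∀ {a b} → a ≡ b → .{pa : InV Δ₀ a} .{pb : InV Δ₀ b} → J.f a pa ≡ J.f b pb
  J-f-cong refl = refl
  J-g-cong : ∀ {a b} → a ≡ b → .{pa : InL Δ₀ a} .{pb : InL Δ₀ b} → J.g a pa ≡ J.g b pb
  J-g-cong refl = refl
  J-φ-cong : ∀ {a b} → a ≡ b → .{pa : InF Δ₀ a} .{pb : InF Δ₀ b} → J.φ a pa ≡ J.φ b pb
  J-φ-cong refl = refl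

module _ {N h : ℕ} (ts : Vec (Transp N) h) where

  private
    endpoint : Fin h → Fin 2 → Fin N
    endpoint k zero       = fst (lookup ts k)
    endpoint k (suc zero) = snd (lookup ts k)

    Used : Fin N → Set
    Used v = ∃₂ λ k b → endpoint k b ≡ v

    used? : ∀ v → Dec (Used v)
    used? v = any? λ k → any? λ b → endpoint k b ≟ v

  unused-value : h * 2 ℕ.< N → ∃ λ c → ∀ k → c ≢ fst (lookup ts k) × c ≢ snd (lookup ts k)
  unused-value 2h<N with all? used?
  ... | yes allUsed = ⊥-elim (ℕₚ.<⇒≱ 2h<N (injective⇒≤ code-injective))
    where
    code : Fin N → Fin (h * 2)
    code v = combine (proj₁ (allUsed v)) (proj₁ (proj₂ (allUsed v)))
    code-injective : ∀ {u v} → code u ≡ code v → u ≡ v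
    code-injective {u} {v} e with combine-injective _ _ _ _ e
    ... | same-k , same-b = trans (sym (proj₂ (proj₂ (allUsed u))))
                                  (trans (cong₂ endpoint same-k same-b) (proj₂ (proj₂ (allUsed v))))
  ... | no notAllUsed with ¬∀⟶∃¬ N Used used? notAllUsed
  ...   | c , unused = c , λ k → (λ c≡a → unused (k , zero , sym c≡a)) , (λ c≡b → unused (k , suc zero , sym c≡b))

bounded-representative : ∀ h n (Γ : Path (suc n) h) → ∃ λ m → m ℕ.≤ h * 2 × Σ (Path (suc m) h) (Iso Γ)
bounded-representative h n Γ with n ℕ.≤? h * 2
... | yes n≤2h = n , n≤2h , Γ , Iso-refl Γ
bounded-representative h zero Γ | no 0≰2h = ⊥-elim (0≰2h ℕ.z≤n)
bounded-representative h (suc n) Γ | no n≰2h =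
  let c , c-unused = unused-value (labs Γ) (ℕₚ.m<n⇒m<1+n (ℕₚ.≰⇒> n≰2h))
      q , x₀q≡c = perm-surjective (lookup (verts Γ) zero) c
      pinned = Deletion.AllPinned-from-start c q Γ c-unused x₀q≡c
      m , m≤2h , Δ , Γ′≅Δ = bounded-representative h n (Deletion.deletePath c q Γ pinned)
  in m , m≤2h , Δ , Iso-trans (Deletion.deletion-iso c q Γ pinned) Γ′≅Δ

-- Enumerating paths

∈-mapMaybe : ∀ {a b} {A : Set a} {B : Set b} (f : A → Maybe B) {x y xs} → x ∈ xs → f x ≡ just y → y ∈ mapMaybe f xs
∈-mapMaybe f {x} {y} {xs} x∈xs fx≡y = mapMaybe⁺ f xs (map⁺ (Any.map (λ { refl → subst (Maybe.Any (y ≡_)) (sym fx≡y) (Maybe.just refl) }) x∈xs))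

vectors : ∀ {a} {A : Set a} → List A → ∀ n → List (Vec A n)
vectors xs zero    = [ [] ]
vectors xs (suc n) = cartesianProductWith _∷_ xs (vectors xs n)

∈-vectors : ∀ {a} {A : Set a} {xs : List A} → (∀ x → x ∈ xs) → ∀ {n} (v : Vec A n) → v ∈ vectors xs n
∈-vectors complete []      = here refl
∈-vectors complete (x ∷ v) = ∈-cartesianProductWith⁺ _∷_ (complete x) (∈-vectors complete v)

toPerm : ∀ {n} → Vec (Fin n) n → Maybe (Perm n)
toPerm v with all? (λ i → all? λ j → (lookup v i ≟ lookup v j) →-dec (i ≟ j))
... | yes injective = just (perm v injective)
... | no _          = nothing

toPerm-vec : ∀ {n} (x : Perm n) → toPerm (vec x) ≡ just x
toPerm-vec (perm v injective) with all? (λ i → all? λ j → (lookup v i ≟ lookup v j) →-dec (i ≟ j))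
... | yes _ = refl
... | no ¬injective = ⊥-elim-irr (¬injective injective)

allPerms : ∀ n → List (Perm n)
allPerms n = mapMaybe toPerm (vectors (allFin n) n)

∈-allPerms : ∀ {n} (x : Perm n) → x ∈ allPerms n
∈-allPerms x = ∈-mapMaybe toPerm (∈-vectors ∈-allFin (vec x)) (toPerm-vec x)

toTransp : ∀ {n} → Fin n × Fin n → Maybe (Transp n)
toTransp (a , b) with a <? b
... | yes a<b = just (tr a b a<b)
... | no _    = nothing

toTransp-ends : ∀ {n} (t : Transp n) → toTransp (fst t , snd t) ≡ just t
toTransp-ends (tr a b a<b) with a <? b
... | yes _ = refl
... | no a≮b = ⊥-elim-irr (a≮b a<b)

allTransps : ∀ n → List (Transp n)
allTransps n = mapMaybe toTransp (cartesianProduct (allFin n) (allFin n))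

∈-allTransps : ∀ {n} (t : Transp n) → t ∈ allTransps n
∈-allTransps t = ∈-mapMaybe toTransp (∈-cartesianProductWith⁺ _,_ (∈-allFin (fst t)) (∈-allFin (snd t))) (toTransp-ends t)

toPath : ∀ {n h} → Vec (Perm n) (suc h) × Vec (Transp n) h → Maybe (Path n h)
toPath (vs , ls) with all? (λ k → edge? (lookup vs (inject₁ k)) (lookup ls k) (lookup vs (suc k)))
... | yes edges = just (path vs ls edges)
... | no _      = nothing

toPath-parts : ∀ {n h} (Γ : Path n h) → toPath (verts Γ , labs Γ) ≡ just Γ
toPath-parts (path vs ls edges) with all? (λ k → edge? (lookup vs (inject₁ k)) (lookup ls k) (lookup vs (suc k)))
... | yes _ = refl
... | no ¬edges = ⊥-elim-irr (¬edges edges)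

allPaths : ∀ n h → List (Path n h)
allPaths n h = mapMaybe toPath (cartesianProduct (vectors (allPerms n) (suc h)) (vectors (allTransps n) h))

∈-allPaths : ∀ {n h} (Γ : Path n h) → Γ ∈ allPaths n h
∈-allPaths Γ = ∈-mapMaybe toPath
  (∈-cartesianProductWith⁺ _,_ (∈-vectors ∈-allPerms (verts Γ)) (∈-vectors ∈-allTransps (labs Γ))) (toPath-parts Γ)

pathsOfSize : (h m : ℕ) → List (Σ ℕ λ m → Path (suc m) h)
pathsOfSize h m = map (m ,_) (allPaths (suc m) h)

∈-pathsOfSize : ∀ {h m} (Δ : Path (suc m) h) → (m , Δ) ∈ pathsOfSize h m
∈-pathsOfSize {h} {m} Δ = ∈-map⁺ (_,_ {B = λ m → Path (suc m) h} m) (∈-allPaths Δ)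

pathsUpTo : (h B : ℕ) → List (Σ ℕ λ m → Path (suc m) h)
pathsUpTo h zero    = pathsOfSize h 0
pathsUpTo h (suc B) = pathsOfSize h (suc B) ++ pathsUpTo h B

∈-pathsUpTo : ∀ {h m} (B : ℕ) → m ℕ.≤ B → (Δ : Path (suc m) h) → (m , Δ) ∈ pathsUpTo h B
∈-pathsUpTo zero    ℕ.z≤n Δ = ∈-pathsOfSize Δ
∈-pathsUpTo {h} (suc B) m≤1+B Δ with ℕₚ.m≤n⇒m<n∨m≡n m≤1+B
... | inj₁ m<1+B = ∈-++⁺ʳ (pathsOfSize h (suc B)) (∈-pathsUpTo B (ℕₚ.≤-pred m<1+B) Δ)
... | inj₂ refl  = ∈-++⁺ˡ (∈-pathsOfSize Δ)

corollary6p13 : (h : ℕ) →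
    Σ (List (Σ ℕ λ m → Path (suc m) h)) λ reps →
      ∀ (n : ℕ) (Γ : Path (suc n) h) → Any (λ r → Iso Γ (proj₂ r)) reps
corollary6p13 h = pathsUpTo h (h * 2) , λ n Γ →
  let m , m≤2h , Δ , Γ≅Δ = bounded-representative h n Γ
  in Any.map (λ { refl → Γ≅Δ }) (∈-pathsUpTo (h * 2) m≤2h Δ)
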